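{- Let $1\le\mathbf{a}<\mathbf{b}$ be two co-prime integers, $k$ a positive integer, and $\widetilde S$ the sumset semigroup generated by $\{0,k\mathbf{a}\}$ and $\{0,k\mathbf{b}\}$, with ideal $I_{\widetilde S}\subset\mathbf{k}[x,y]$ ($x$ corresponding to $\{0,k\mathbf{a}\}$, $y$ to $\{0,k\mathbf{b}\}$). Then $I_{\widetilde S}$ is the principal ideal generated by $x^{\mathbf{b}-1}y^{\mathbf{a}-1}(x^{\mathbf{b}}-y^{\mathbf{a}})$.
   Context: For finite non-empty $A,B\subset\mathbb{N}$, $A+B=\{a+b\mid a\in A,b\in B\}$, and $\alpha\otimes A$ is the $\alpha$-fold sum of $A$ with itself ($0\otimes A=\{0\}$). The ideal of the sumset semigroup generated by $A_1,A_2$ is the binomial ideal $I\subset\mathbf{k}[x,y]$ ($\mathbf{k}$ a field) generated by all $x^{\alpha_1}y^{\alpha_2}-x^{\beta_1}y^{\beta_2}$ with $\alpha_1\otimes A_1+\alpha_2\otimes A_2=\beta_1\otimes A_1+\beta_2\otimes A_2$. -}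

module Defs where

open import Level using (Level; _⊔_; suc)
open import Data.Nat as ℕ using (ℕ; zero; _∸_; _≤_; _≟_)
open import Data.Product using (Σ; ∃; _×_; _,_; proj₁; proj₂)
open import Data.Sum using (_⊎_)
open import Data.List using (List; []; _∷_)
open import Data.List.Relation.Unary.All using (All)
open import Relation.Nullary using (¬_; yes; no)
open import Relation.Binary.PropositionalEquality using (_≡_)
open import Algebra.Bundles using (CommutativeRing)

record Field (c ℓ : Level) : Set (Level.suc (c ⊔ ℓ)) where
  field
    commutativeRing : CommutativeRing c ℓ
  open CommutativeRing commutativeRing public
  field
    1≉0     : ¬ (1# ≈ 0#)
    inverse : ∀ x → ¬ (x ≈ 0#) → Σ Carrier λ y → x * y ≈ 1#

Subset : Set₁
Subset = ℕ → Set

_⊕_ : Subset → Subset → Subset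
(A ⊕ B) n = Σ ℕ λ a → Σ ℕ λ b → A a × B b × n ≡ a ℕ.+ b

_⊗_ : ℕ → Subset → Subset
(zero ⊗ A) n = n ≡ 0
(ℕ.suc α ⊗ A) = A ⊕ (α ⊗ A)

_≐_ : Subset → Subset → Set
A ≐ B = ∀ n → (A n → B n) × (B n → A n)

pair0 : ℕ → Subset
pair0 m n = n ≡ 0 ⊎ n ≡ m

-- Polynomials in k[x,y], represented by their coefficient functions:
-- p i j is the coefficient of x^i y^j. A genuine polynomial is one
-- with finite support.

module Poly {c ℓ} (K : Field c ℓ) where
  open Field K

  Pol : Set c
  Pol = ℕ → ℕ → Carrier

  FiniteSupport : Pol → Set ℓ
  FiniteSupport p = Σ ℕ λ N → ∀ i j → N ≤ i ℕ.+ j → p i j ≈ 0#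

  _≈ₚ_ : Pol → Pol → Set ℓ
  p ≈ₚ q = ∀ i j → p i j ≈ q i j

  0ₚ : Pol
  0ₚ _ _ = 0#

  _+ₚ_ : Pol → Pol → Pol
  (p +ₚ q) i j = p i j + q i j

  _-ₚ_ : Pol → Pol → Pol
  (p -ₚ q) i j = p i j - q i j

  sumTo : ℕ → (ℕ → Carrier) → Carrier
  sumTo zero f = f 0
  sumTo (ℕ.suc n) f = sumTo n f + f (ℕ.suc n)

  _*ₚ_ : Pol → Pol → Pol
  (p *ₚ q) i j = sumTo i λ u → sumTo j λ v → p u v * q (i ∸ u) (j ∸ v)

  mono : ℕ → ℕ → Pol
  mono α β i j with i ≟ α | j ≟ β
  ... | yes _ | yes _ = 1#
  ... | _     | _     = 0#

  binom : ℕ → ℕ → ℕ → ℕ → Pol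
  binom α₁ α₂ β₁ β₂ = mono α₁ α₂ -ₚ mono β₁ β₂

  combine : {G : Set} → (G → Pol) → List (Pol × G) → Pol
  combine g [] = 0ₚ
  combine g ((c' , t) ∷ l) = (c' *ₚ g t) +ₚ combine g l

  InIdeal : {G : Set} → (G → Pol) → Pol → Set (c ⊔ ℓ)
  InIdeal {G} g p = Σ (List (Pol × G)) λ l →
    All (λ ct → FiniteSupport (proj₁ ct)) l × p ≈ₚ combine g l

  InPrincipal : Pol → Pol → Set (c ⊔ ℓ)
  InPrincipal f p = Σ Pol λ q → FiniteSupport q × p ≈ₚ (q *ₚ f)

record SumsetRel (A₁ A₂ : Subset) : Set where
  field
    α₁ α₂ β₁ β₂ : ℕ
    rel : ((α₁ ⊗ A₁) ⊕ (α₂ ⊗ A₂)) ≐ ((β₁ ⊗ A₁) ⊕ (β₂ ⊗ A₂))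

module _ {c ℓ} (K : Field c ℓ) where
  open Poly K

  sumsetGen : (A₁ A₂ : Subset) → SumsetRel A₁ A₂ → Pol
  sumsetGen A₁ A₂ r = binom α₁ α₂ β₁ β₂
    where open SumsetRel r

  InSumsetIdeal : (A₁ A₂ : Subset) → Pol → Set (c ⊔ ℓ)
  InSumsetIdeal A₁ A₂ = InIdeal (sumsetGen A₁ A₂)

-- Writing u = k a and v = k b, the sumset α₁ ⊗ {0, u} + α₂ ⊗ {0, v} is
-- {u i + v j ∣ i ≤ α₁, j ≤ α₂}; after cancelling k, two exponent pairs give the
-- same sumset only if they are equal or differ by an exchange
-- (β₁ + s b, α₂) ~ (β₁, α₂ + s a) with β₁ ≥ b - 1 and α₂ ≥ a - 1. Comparing maximal
-- elements gives a α₁ + b α₂ = a β₁ + b β₂, coprimality then gives the shift s,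
-- and the elements a (β₁ + 1) and b (α₂ + 1) give the lower bounds. Such a relation
-- contributes x^β₁ y^α₂ (x^(s b) - y^(s a)), a multiple of
-- x^(b-1) y^(a-1) (x^b - y^a), which is itself the contribution for s = 1.
module Submission where

open import Defs
open import Data.Nat using (ℕ)

module SumsetsOfPairs where
  open import Data.Nat
  open import Data.Nat.Properties
  open import Data.Nat.Divisibility using (divides; ∣⇒≤)
  open import Data.Nat.Coprimality using (Coprime; coprime-divisor)
  import Data.Nat.Coprimality as Coprime
  open import Data.Nat.Tactic.RingSolver using (solve-∀)
  open import Data.Product using (∃-syntax; _×_; _,_)
  open import Function using (_∘_)
  open import Data.Sum using (_⊎_; inj₁; inj₂; map; map₂)
  open import Relation.Unary using (_⊆_)
  open import Relation.Nullary using (yes; no)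
  open import Relation.Binary.PropositionalEquality
  open ≡-Reasoning

  ⊗-pair0⁻ : ∀ α {m n} → (α ⊗ pair0 m) n → ∃[ i ] i ≤ α × n ≡ m * i
  ⊗-pair0⁻ zero {m} n≡0 = 0 , z≤n , trans n≡0 (sym (*-zeroʳ m))
  ⊗-pair0⁻ (suc α) {m} (x , y , x∈ , y∈ , n≡x+y) with ⊗-pair0⁻ α y∈
  ... | i , i≤α , refl with x∈
  ...   | inj₁ refl = i , m≤n⇒m≤1+n i≤α , n≡x+y
  ...   | inj₂ refl = suc i , s≤s i≤α , trans n≡x+y (sym (*-suc m i))

  ⊗-pair0⁺ : ∀ {α i} m → i ≤ α → (α ⊗ pair0 m) (m * i)
  ⊗-pair0⁺ {zero} m z≤n = *-zeroʳ m
  ⊗-pair0⁺ {suc α} {zero} m _ = 0 , m * 0 , inj₁ refl , ⊗-pair0⁺ {α} m z≤n , refl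
  ⊗-pair0⁺ {suc α} {suc i} m (s≤s i≤α) = m , m * i , inj₂ refl , ⊗-pair0⁺ {α} m i≤α , *-suc m i

  Span : ℕ → ℕ → ℕ → ℕ → Subset
  Span u v α₁ α₂ = (α₁ ⊗ pair0 u) ⊕ (α₂ ⊗ pair0 v)

  span⁻ : ∀ α₁ α₂ {u v n} → Span u v α₁ α₂ n →
    ∃[ i ] ∃[ j ] i ≤ α₁ × j ≤ α₂ × n ≡ u * i + v * j
  span⁻ α₁ α₂ (x , y , x∈ , y∈ , n≡x+y) with ⊗-pair0⁻ α₁ x∈ | ⊗-pair0⁻ α₂ y∈
  ... | i , i≤α₁ , refl | j , j≤α₂ , refl = i , j , i≤α₁ , j≤α₂ , n≡x+y

  span⁺ : ∀ {u v α₁ α₂ i j} → i ≤ α₁ → j ≤ α₂ → Span u v α₁ α₂ (u * i + v * j)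
  span⁺ {u} {v} i≤α₁ j≤α₂ = _ , _ , ⊗-pair0⁺ u i≤α₁ , ⊗-pair0⁺ v j≤α₂ , refl

  span-swap : ∀ {u v α₁ α₂} → Span u v α₁ α₂ ⊆ Span v u α₂ α₁
  span-swap (x , y , x∈ , y∈ , n≡x+y) = y , x , y∈ , x∈ , trans n≡x+y (+-comm x y)

  span-⊆-swap : ∀ {u v} α₁ α₂ β₁ β₂ →
    Span u v α₁ α₂ ⊆ Span u v β₁ β₂ → Span v u α₂ α₁ ⊆ Span v u β₂ β₁
  span-⊆-swap {u} {v} α₁ α₂ β₁ β₂ α⊆β =
    span-swap {u} {v} {β₁} {β₂} ∘ α⊆β ∘ span-swap {v} {u} {α₂} {α₁}

  span-unscale : ∀ {k a b} α₁ α₂ β₁ β₂ .{{_ : NonZero k}} →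
    Span (k * a) (k * b) α₁ α₂ ⊆ Span (k * a) (k * b) β₁ β₂ → Span a b α₁ α₂ ⊆ Span a b β₁ β₂
  span-unscale {k} {a} {b} α₁ α₂ β₁ β₂ α⊆β n∈ with span⁻ α₁ α₂ n∈
  ... | i , j , i≤α₁ , j≤α₂ , refl with span⁻ β₁ β₂ (α⊆β (span⁺ i≤α₁ j≤α₂))
  ...   | i′ , j′ , i′≤β₁ , j′≤β₂ , eq =
    subst (Span a b β₁ β₂) (sym (*-cancelˡ-≡ _ _ k (begin
      k * (a * i + b * j)      ≡⟨ scale k a b i j ⟨
      k * a * i + k * b * j    ≡⟨ eq ⟩
      k * a * i′ + k * b * j′  ≡⟨ scale k a b i′ j′ ⟩
      k * (a * i′ + b * j′)    ∎))) (span⁺ i′≤β₁ j′≤β₂)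
    where
    scale : ∀ k a b i j → k * a * i + k * b * j ≡ k * (a * i + b * j)
    scale = solve-∀

  span-weight-≤ : ∀ {a b} α₁ α₂ β₁ β₂ → Span a b α₁ α₂ ⊆ Span a b β₁ β₂ →
    a * α₁ + b * α₂ ≤ a * β₁ + b * β₂
  span-weight-≤ {a} {b} α₁ α₂ β₁ β₂ α⊆β
    with span⁻ β₁ β₂ (α⊆β (span⁺ (≤-refl {α₁}) (≤-refl {α₂})))
  ... | i , j , i≤β₁ , j≤β₂ , eq =
    subst (_≤ a * β₁ + b * β₂) (sym eq) (+-mono-≤ (*-monoʳ-≤ a i≤β₁) (*-monoʳ-≤ b j≤β₂))

  coprime-*≡* : ∀ {a b d e} → Coprime a b → .{{_ : NonZero b}} → a * d ≡ b * e →
    ∃[ s ] d ≡ s * b × e ≡ s * a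
  coprime-*≡* {a} {b} {d} {e} cop ad≡be
    with coprime-divisor (Coprime.sym cop) (divides e (trans ad≡be (*-comm b e)))
  ... | divides s refl = s , refl , *-cancelˡ-≡ e (s * a) b (begin
    b * e        ≡⟨ ad≡be ⟨
    a * (s * b)  ≡⟨ exchange a b s ⟩
    b * (s * a)  ∎)
    where
    exchange : ∀ a b s → a * (s * b) ≡ b * (s * a)
    exchange = solve-∀

  a*n≡a*i+b*j⇒b≤n : ∀ {a b n i j} → Coprime a b → a * n ≡ a * i + b * j → i < n → b ≤ n
  a*n≡a*i+b*j⇒b≤n {a} {b} {n} {i} {j} cop eq i<n =
    ≤-trans (∣⇒≤ {{>-nonZero (m<n⇒0<n∸m i<n)}} b∣n∸i) (m∸n≤m n i)
    where
    a*[n∸i]≡b*j : a * (n ∸ i) ≡ b * j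
    a*[n∸i]≡b*j = +-cancelˡ-≡ (a * i) _ _ (begin
      a * i + a * (n ∸ i)  ≡⟨ *-distribˡ-+ a i (n ∸ i) ⟨
      a * (i + (n ∸ i))    ≡⟨ cong (a *_) (m+[n∸m]≡n (<⇒≤ i<n)) ⟩
      a * n                ≡⟨ eq ⟩
      a * i + b * j        ∎)
    b∣n∸i = coprime-divisor (Coprime.sym cop) (divides j (trans a*[n∸i]≡b*j (*-comm b j)))

  coprime-*+≡* : ∀ {a b d m n} → Coprime a b → .{{_ : NonZero b}} → a * d + b * m ≡ b * n →
    ∃[ s ] d ≡ s * b × n ≡ m + s * a
  coprime-*+≡* {a} {b} {d} {m} {n} cop eq with m≤n⇒∃[o]m+o≡n m≤n
    where
    m≤n : m ≤ n
    m≤n = *-cancelˡ-≤ b (subst (b * m ≤_) eq (m≤n+m (b * m) (a * d)))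
  ... | e , refl with coprime-*≡* cop (+-cancelʳ-≡ (b * m) (a * d) (b * e) (begin
    a * d + b * m   ≡⟨ eq ⟩
    b * (m + e)     ≡⟨ *-distribˡ-+ b m e ⟩
    b * m + b * e   ≡⟨ +-comm (b * m) (b * e) ⟩
    b * e + b * m   ∎))
  ...   | s , d≡s*b , e≡s*a = s , d≡s*b , cong (m +_) e≡s*a

  coprime-balance : ∀ {a b α₁ α₂ β₁ β₂} → Coprime a b → .{{_ : NonZero b}} → β₁ ≤ α₁ →
    a * α₁ + b * α₂ ≡ a * β₁ + b * β₂ → ∃[ s ] α₁ ≡ β₁ + s * b × β₂ ≡ α₂ + s * a
  coprime-balance {a} {b} {α₁} {α₂} {β₁} {β₂} cop β₁≤α₁ eq with m≤n⇒∃[o]m+o≡n β₁≤α₁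
  ... | d , refl with coprime-*+≡* cop (+-cancelˡ-≡ (a * β₁) _ _ (trans (regroup a b β₁ d α₂) eq))
    where
    regroup : ∀ a b β₁ d α₂ → a * β₁ + (a * d + b * α₂) ≡ a * (β₁ + d) + b * α₂
    regroup = solve-∀
  ...   | s , d≡s*b , β₂≡α₂+s*a = s , cong (β₁ +_) d≡s*b , β₂≡α₂+s*a

  span-lower-bound : ∀ {a b} α₁ α₂ β₁ β₂ → Coprime a b →
    Span a b α₁ α₂ ⊆ Span a b β₁ β₂ → β₁ < α₁ → b ≤ suc β₁
  span-lower-bound {a} {b} α₁ α₂ β₁ β₂ cop α⊆β β₁<α₁
    with span⁻ β₁ β₂ (α⊆β (span⁺ {α₂ = α₂} {j = 0} β₁<α₁ z≤n))
  ... | i , j , i≤β₁ , _ , eq = a*n≡a*i+b*j⇒b≤n cop a*[1+β₁]≡a*i+b*j (s≤s i≤β₁)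
    where
    a*[1+β₁]≡a*i+b*j : a * suc β₁ ≡ a * i + b * j
    a*[1+β₁]≡a*i+b*j = begin
      a * suc β₁          ≡⟨ +-identityʳ _ ⟨
      a * suc β₁ + 0      ≡⟨ cong (a * suc β₁ +_) (*-zeroʳ b) ⟨
      a * suc β₁ + b * 0  ≡⟨ eq ⟩
      a * i + b * j       ∎

  record Exchange (a b α₁ α₂ β₁ β₂ : ℕ) : Set where
    field
      steps    : ℕ
      α₁-eq    : α₁ ≡ β₁ + steps * b
      β₂-eq    : β₂ ≡ α₂ + steps * a
      b≤1+β₁   : b ≤ suc β₁
      a≤1+α₂   : a ≤ suc α₂

  exchange-or-equal : ∀ {a b} α₁ α₂ β₁ β₂ → Coprime a b → .{{_ : NonZero a}} → .{{_ : NonZero b}} →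
    Span a b α₁ α₂ ⊆ Span a b β₁ β₂ → Span a b β₁ β₂ ⊆ Span a b α₁ α₂ → β₁ ≤ α₁ →
    (α₁ ≡ β₁ × α₂ ≡ β₂) ⊎ Exchange a b α₁ α₂ β₁ β₂
  exchange-or-equal {a} {b} α₁ α₂ β₁ β₂ cop α⊆β β⊆α β₁≤α₁
    with coprime-balance cop β₁≤α₁
           (≤-antisym (span-weight-≤ α₁ α₂ β₁ β₂ α⊆β) (span-weight-≤ β₁ β₂ α₁ α₂ β⊆α))
  ... | zero , α₁≡β₁+0 , β₂≡α₂+0 =
    inj₁ (trans α₁≡β₁+0 (+-identityʳ β₁) , sym (trans β₂≡α₂+0 (+-identityʳ α₂)))
  ... | s@(suc _) , α₁-eq , β₂-eq = inj₂ (record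
    { steps = s ; α₁-eq = α₁-eq ; β₂-eq = β₂-eq
    ; b≤1+β₁ = span-lower-bound α₁ α₂ β₁ β₂ cop α⊆β (subst (β₁ <_) (sym α₁-eq) (m<m+s*n β₁ b))
    ; a≤1+α₂ = span-lower-bound β₂ β₁ α₂ α₁ (Coprime.sym cop) (span-⊆-swap β₁ β₂ α₁ α₂ β⊆α)
                 (subst (α₂ <_) (sym β₂-eq) (m<m+s*n α₂ a))
    })
    where
    m<m+s*n : ∀ m n .{{_ : NonZero n}} → m < m + s * n
    m<m+s*n m n = m<m+n m (>-nonZero⁻¹ (s * n) {{m*n≢0 s n}})

  classify : ∀ {a b} α₁ α₂ β₁ β₂ → Coprime a b → .{{_ : NonZero a}} → .{{_ : NonZero b}} →
    Span a b α₁ α₂ ⊆ Span a b β₁ β₂ → Span a b β₁ β₂ ⊆ Span a b α₁ α₂ →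
    (α₁ ≡ β₁ × α₂ ≡ β₂) ⊎ Exchange a b α₁ α₂ β₁ β₂ ⊎ Exchange a b β₁ β₂ α₁ α₂
  classify α₁ α₂ β₁ β₂ cop α⊆β β⊆α with ≤-total β₁ α₁
  ... | inj₁ β₁≤α₁ = map₂ inj₁ (exchange-or-equal α₁ α₂ β₁ β₂ cop α⊆β β⊆α β₁≤α₁)
  ... | inj₂ α₁≤β₁ =
    map (λ (p , q) → sym p , sym q) inj₂ (exchange-or-equal β₁ β₂ α₁ α₂ cop β⊆α α⊆β α₁≤β₁)

  span-shift : ∀ {u v a b} P Q → u * b ≡ v * a → b ≤ suc P →
    Span u v (P + b) Q ⊆ Span u v P (Q + a)
  span-shift {u} {v} {a} {b} P Q ub≡va b≤1+P n∈ with span⁻ (P + b) Q n∈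
  ... | i , j , i≤P+b , j≤Q , refl with i ≤? P
  ...   | yes i≤P = span⁺ i≤P (≤-trans j≤Q (m≤m+n Q a))
  ...   | no i≰P with m≤n⇒∃[o]m+o≡n (≤-trans b≤1+P (≰⇒> i≰P))
  ...     | i′ , refl = subst (Span u v P (Q + a)) (sym moved) (span⁺ i′≤P (+-monoˡ-≤ a j≤Q))
    where
    i′≤P : i′ ≤ P
    i′≤P = +-cancelʳ-≤ b i′ P (subst (_≤ P + b) (+-comm b i′) i≤P+b)
    regroup : ∀ u v a i′ j → v * a + u * i′ + v * j ≡ u * i′ + v * (j + a)
    regroup = solve-∀
    moved : u * (b + i′) + v * j ≡ u * i′ + v * (j + a)
    moved = begin
      u * (b + i′) + v * j     ≡⟨ cong (_+ v * j) (*-distribˡ-+ u b i′) ⟩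
      u * b + u * i′ + v * j   ≡⟨ cong (λ w → w + u * i′ + v * j) ub≡va ⟩
      v * a + u * i′ + v * j   ≡⟨ regroup u v a i′ j ⟩
      u * i′ + v * (j + a)     ∎

  span-exchange : ∀ {u v a b} P Q → u * b ≡ v * a → b ≤ suc P → a ≤ suc Q →
    Span u v (P + b) Q ≐ Span u v P (Q + a)
  span-exchange {u} {v} {a} {b} P Q ub≡va b≤1+P a≤1+Q n =
    span-shift P Q ub≡va b≤1+P ,
    span-swap {v} {u} {Q} {P + b} ∘ span-shift Q P (sym ub≡va) a≤1+Q ∘ span-swap {u} {v} {P} {Q + a}

module Polynomials {c ℓ} (K : Field c ℓ) where
  open Field K
  open Poly K
  open import Data.Nat as ℕ using (zero; suc; _∸_; z≤n; s≤s)
  import Data.Nat.Properties as ℕ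
  open import Data.Product using (_×_; _,_; proj₁)
  open import Data.List using ([]; _∷_)
  open import Data.List.Relation.Unary.All using (All; []; _∷_)
  open import Level using (_⊔_)
  open import Relation.Nullary using (¬_; yes; no)
  open import Data.Empty using (⊥-elim)
  open import Relation.Nullary.Decidable using (_×-dec_)
  open import Relation.Binary.PropositionalEquality as ≡ using (_≡_)
  open import Relation.Binary.Bundles using (Setoid)
  import Relation.Binary.Reasoning.Setoid as SetoidReasoning
  import Algebra.Properties.Ring as RingProperties
  import Algebra.Properties.AbelianGroup as AbelianGroupProperties
  import Algebra.Properties.CommutativeSemigroup as CommutativeSemigroupProperties
  open RingProperties ring using (-‿distribˡ-*; -‿distribʳ-*; -0#≈0#)
  open AbelianGroupProperties +-abelianGroup using (⁻¹-∙-comm; ⁻¹-anti-homo‿-)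
  open CommutativeSemigroupProperties +-commutativeSemigroup using (interchange)

  sumTo-cong : ∀ n {f g : ℕ → Carrier} → (∀ u → u ℕ.≤ n → f u ≈ g u) → sumTo n f ≈ sumTo n g
  sumTo-cong zero f≈g = f≈g 0 z≤n
  sumTo-cong (suc n) f≈g =
    +-cong (sumTo-cong n (λ u u≤n → f≈g u (ℕ.m≤n⇒m≤1+n u≤n))) (f≈g (suc n) ℕ.≤-refl)

  sumTo-zero : ∀ n {f : ℕ → Carrier} → (∀ u → f u ≈ 0#) → sumTo n f ≈ 0#
  sumTo-zero zero f≈0 = f≈0 0
  sumTo-zero (suc n) f≈0 = trans (+-cong (sumTo-zero n f≈0) (f≈0 (suc n))) (+-identityˡ 0#)

  sumTo-+ : ∀ n (f g : ℕ → Carrier) → sumTo n (λ u → f u + g u) ≈ sumTo n f + sumTo n g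
  sumTo-+ zero f g = refl
  sumTo-+ (suc n) f g = trans (+-cong (sumTo-+ n f g) refl) (interchange _ _ _ _)

  sumTo-neg : ∀ n (f : ℕ → Carrier) → sumTo n (λ u → - f u) ≈ - sumTo n f
  sumTo-neg zero f = refl
  sumTo-neg (suc n) f = trans (+-cong (sumTo-neg n f) refl) (⁻¹-∙-comm _ _)

  sumTo-unfoldˡ : ∀ n (f : ℕ → Carrier) → sumTo (suc n) f ≈ f 0 + sumTo n (λ u → f (suc u))
  sumTo-unfoldˡ zero f = refl
  sumTo-unfoldˡ (suc n) f = trans (+-cong (sumTo-unfoldˡ n f) refl) (+-assoc _ _ _)

  sumTo-head : ∀ n (f : ℕ → Carrier) → (∀ u → f (suc u) ≈ 0#) → sumTo n f ≈ f 0
  sumTo-head zero f _ = refl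
  sumTo-head (suc n) f tail≈0 =
    trans (sumTo-unfoldˡ n f) (trans (+-cong refl (sumTo-zero n tail≈0)) (+-identityʳ _))

  prepend : ∀ {a} {A : Set a} → A → (ℕ → A) → ℕ → A
  prepend z h zero = z
  prepend z h (suc w) = h w

  -- A Cauchy product with one factor shifted by one index (padded with z, which Φ
  -- annihilates) is the unshifted product one index lower.
  sumTo-prependʳ : ∀ {a} {A : Set a} (z : A) (h : ℕ → A) (Φ : ℕ → A → Carrier) →
    (∀ u → Φ u z ≈ 0#) → ∀ n →
    sumTo (suc n) (λ u → Φ u (prepend z h (suc n ∸ u))) ≈ sumTo n (λ u → Φ u (h (n ∸ u)))
  sumTo-prependʳ z h Φ Φz≈0 n = trans (+-cong (sumTo-cong n shifted) last≈0) (+-identityʳ _)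
    where
    shifted : ∀ u → u ℕ.≤ n → Φ u (prepend z h (suc n ∸ u)) ≈ Φ u (h (n ∸ u))
    shifted u u≤n = reflexive (≡.cong (λ w → Φ u (prepend z h w)) (ℕ.+-∸-assoc 1 u≤n))
    last≈0 : Φ (suc n) (prepend z h (n ∸ n)) ≈ 0#
    last≈0 = trans (reflexive (≡.cong (λ w → Φ (suc n) (prepend z h w)) (ℕ.n∸n≡0 n))) (Φz≈0 (suc n))

  sumTo-prependˡ : ∀ {a} {A : Set a} (z : A) (h : ℕ → A) (Φ : A → ℕ → Carrier) →
    (∀ m → Φ z m ≈ 0#) → ∀ n →
    sumTo (suc n) (λ u → Φ (prepend z h u) (suc n ∸ u)) ≈ sumTo n (λ u → Φ (h u) (n ∸ u))
  sumTo-prependˡ z h Φ Φz≈0 n =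
    trans (sumTo-unfoldˡ n _) (trans (+-cong (Φz≈0 (suc n)) refl) (+-identityˡ _))

  ≈ₚ-setoid : Setoid c ℓ
  ≈ₚ-setoid = record
    { Carrier = Pol
    ; _≈_ = _≈ₚ_
    ; isEquivalence = record
      { refl = λ i j → refl
      ; sym = λ p≈q i j → sym (p≈q i j)
      ; trans = λ p≈q q≈r i j → trans (p≈q i j) (q≈r i j)
      }
    }

  open Setoid ≈ₚ-setoid public using ()
    renaming (refl to ≈ₚ-refl; reflexive to ≈ₚ-reflexive; sym to ≈ₚ-sym; trans to ≈ₚ-trans)

  -ₚ_ : Pol → Pol
  (-ₚ p) i j = - p i j

  x·_ : Pol → Pol
  x· p = prepend (λ _ → 0#) p

  y·_ : Pol → Pol
  (y· p) i = prepend 0# (p i)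

  x^_·_ : ℕ → Pol → Pol
  x^ zero · p = p
  x^ suc n · p = x· (x^ n · p)

  y^_·_ : ℕ → Pol → Pol
  y^ zero · p = p
  y^ suc n · p = y· (y^ n · p)

  *ₚ-congˡ : ∀ {p p′} q → p ≈ₚ p′ → (p *ₚ q) ≈ₚ (p′ *ₚ q)
  *ₚ-congˡ q p≈p′ i j = sumTo-cong i (λ u _ → sumTo-cong j (λ v _ → *-cong (p≈p′ _ _) refl))

  *ₚ-congʳ : ∀ p {q q′} → q ≈ₚ q′ → (p *ₚ q) ≈ₚ (p *ₚ q′)
  *ₚ-congʳ p q≈q′ i j = sumTo-cong i (λ u _ → sumTo-cong j (λ v _ → *-cong refl (q≈q′ _ _)))

  *ₚ-distribˡ : ∀ p q r → (p *ₚ (q +ₚ r)) ≈ₚ ((p *ₚ q) +ₚ (p *ₚ r))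
  *ₚ-distribˡ p q r i j =
    trans (sumTo-cong i (λ u _ → trans (sumTo-cong j (λ v _ → distribˡ _ _ _)) (sumTo-+ j _ _)))
          (sumTo-+ i _ _)

  *ₚ-distribʳ : ∀ p q r → ((p +ₚ q) *ₚ r) ≈ₚ ((p *ₚ r) +ₚ (q *ₚ r))
  *ₚ-distribʳ p q r i j =
    trans (sumTo-cong i (λ u _ → trans (sumTo-cong j (λ v _ → distribʳ _ _ _)) (sumTo-+ j _ _)))
          (sumTo-+ i _ _)

  *ₚ-negʳ : ∀ p q → (p *ₚ (-ₚ q)) ≈ₚ (-ₚ (p *ₚ q))
  *ₚ-negʳ p q i j =
    trans (sumTo-cong i (λ u _ → trans (sumTo-cong j (λ v _ → sym (-‿distribʳ-* _ _))) (sumTo-neg j _)))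
          (sumTo-neg i _)

  *ₚ-negˡ : ∀ p q → ((-ₚ p) *ₚ q) ≈ₚ (-ₚ (p *ₚ q))
  *ₚ-negˡ p q i j =
    trans (sumTo-cong i (λ u _ → trans (sumTo-cong j (λ v _ → sym (-‿distribˡ-* _ _))) (sumTo-neg j _)))
          (sumTo-neg i _)

  *ₚ-zeroʳ : ∀ p → (p *ₚ 0ₚ) ≈ₚ 0ₚ
  *ₚ-zeroʳ p i j = sumTo-zero i (λ u → sumTo-zero j (λ v → zeroʳ _))

  *ₚ-zeroˡ : ∀ p → (0ₚ *ₚ p) ≈ₚ 0ₚ
  *ₚ-zeroˡ p i j = sumTo-zero i (λ u → sumTo-zero j (λ v → zeroˡ _))

  *ₚ-identityˡ : ∀ p → (mono 0 0 *ₚ p) ≈ₚ p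
  *ₚ-identityˡ p i j =
    trans (sumTo-head i _ (λ u → sumTo-zero j (λ v → zeroˡ _)))
          (trans (sumTo-head j _ (λ v → zeroˡ _)) (*-identityˡ _))

  *ₚ-x·ʳ : ∀ p q → (p *ₚ (x· q)) ≈ₚ (x· (p *ₚ q))
  *ₚ-x·ʳ p q zero j = sumTo-zero j (λ v → zeroʳ _)
  *ₚ-x·ʳ p q (suc i) j = sumTo-prependʳ (λ _ → 0#) q (λ u row → sumTo j (λ v → p u v * row (j ∸ v)))
    (λ u → sumTo-zero j (λ v → zeroʳ _)) i

  *ₚ-x·ˡ : ∀ p q → ((x· p) *ₚ q) ≈ₚ (x· (p *ₚ q))
  *ₚ-x·ˡ p q zero j = sumTo-zero j (λ v → zeroˡ _)
  *ₚ-x·ˡ p q (suc i) j = sumTo-prependˡ (λ _ → 0#) p (λ row m → sumTo j (λ v → row v * q m (j ∸ v)))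
    (λ m → sumTo-zero j (λ v → zeroˡ _)) i

  *ₚ-y·ʳ : ∀ p q → (p *ₚ (y· q)) ≈ₚ (y· (p *ₚ q))
  *ₚ-y·ʳ p q i zero = sumTo-zero i (λ u → zeroʳ _)
  *ₚ-y·ʳ p q i (suc j) =
    sumTo-cong i (λ u _ → sumTo-prependʳ 0# (q (i ∸ u)) (λ v x → p u v * x) (λ v → zeroʳ _) j)

  *ₚ-y·ˡ : ∀ p q → ((y· p) *ₚ q) ≈ₚ (y· (p *ₚ q))
  *ₚ-y·ˡ p q i zero = sumTo-zero i (λ u → zeroˡ _)
  *ₚ-y·ˡ p q i (suc j) =
    sumTo-cong i (λ u _ → sumTo-prependˡ 0# (p u) (λ x m → x * q (i ∸ u) m) (λ m → zeroˡ _) j)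

  x·-cong : ∀ {p q} → p ≈ₚ q → (x· p) ≈ₚ (x· q)
  x·-cong p≈q zero j = refl
  x·-cong p≈q (suc i) j = p≈q i j

  y·-cong : ∀ {p q} → p ≈ₚ q → (y· p) ≈ₚ (y· q)
  y·-cong p≈q i zero = refl
  y·-cong p≈q i (suc j) = p≈q i j

  x^·-cong : ∀ n {p q} → p ≈ₚ q → (x^ n · p) ≈ₚ (x^ n · q)
  x^·-cong zero p≈q = p≈q
  x^·-cong (suc n) p≈q = x·-cong (x^·-cong n p≈q)

  y^·-cong : ∀ n {p q} → p ≈ₚ q → (y^ n · p) ≈ₚ (y^ n · q)
  y^·-cong zero p≈q = p≈q
  y^·-cong (suc n) p≈q = y·-cong (y^·-cong n p≈q)

  *ₚ-x^·ˡ : ∀ n p q → ((x^ n · p) *ₚ q) ≈ₚ (x^ n · (p *ₚ q))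
  *ₚ-x^·ˡ zero p q = ≈ₚ-refl
  *ₚ-x^·ˡ (suc n) p q = ≈ₚ-trans (*ₚ-x·ˡ _ q) (x·-cong (*ₚ-x^·ˡ n p q))

  *ₚ-y^·ˡ : ∀ n p q → ((y^ n · p) *ₚ q) ≈ₚ (y^ n · (p *ₚ q))
  *ₚ-y^·ˡ zero p q = ≈ₚ-refl
  *ₚ-y^·ˡ (suc n) p q = ≈ₚ-trans (*ₚ-y·ˡ _ q) (y·-cong (*ₚ-y^·ˡ n p q))

  x·-distrib-ₚ : ∀ p q → (x· (p -ₚ q)) ≈ₚ ((x· p) -ₚ (x· q))
  x·-distrib-ₚ p q zero j = sym (-‿inverseʳ 0#)
  x·-distrib-ₚ p q (suc i) j = refl

  y·-distrib-ₚ : ∀ p q → (y· (p -ₚ q)) ≈ₚ ((y· p) -ₚ (y· q))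
  y·-distrib-ₚ p q i zero = sym (-‿inverseʳ 0#)
  y·-distrib-ₚ p q i (suc j) = refl

  mono-yes : ∀ α β → mono α β α β ≈ 1#
  mono-yes α β with α ℕ.≟ α | β ℕ.≟ β
  ... | yes _ | yes _ = refl
  ... | no α≢α | _ = ⊥-elim (α≢α ≡.refl)
  ... | yes _ | no β≢β = ⊥-elim (β≢β ≡.refl)

  mono-no : ∀ α β i j → ¬ (i ≡ α × j ≡ β) → mono α β i j ≈ 0#
  mono-no α β i j ¬eq with i ℕ.≟ α | j ℕ.≟ β
  ... | yes i≡α | yes j≡β = ⊥-elim (¬eq (i≡α , j≡β))
  ... | no _ | _ = refl
  ... | yes _ | no _ = refl

  x·-mono : ∀ α β → (x· mono α β) ≈ₚ mono (suc α) β
  x·-mono α β zero j = sym (mono-no (suc α) β 0 j λ { (() , _) })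
  x·-mono α β (suc i) j with (i ℕ.≟ α) ×-dec (j ℕ.≟ β)
  ... | yes (≡.refl , ≡.refl) = trans (mono-yes α β) (sym (mono-yes (suc α) β))
  ... | no ¬eq = trans (mono-no α β i j ¬eq)
                   (sym (mono-no (suc α) β (suc i) j (λ (e , f) → ¬eq (ℕ.suc-injective e , f))))

  y·-mono : ∀ α β → (y· mono α β) ≈ₚ mono α (suc β)
  y·-mono α β i zero = sym (mono-no α (suc β) i 0 λ { (_ , ()) })
  y·-mono α β i (suc j) with (i ℕ.≟ α) ×-dec (j ℕ.≟ β)
  ... | yes (≡.refl , ≡.refl) = trans (mono-yes α β) (sym (mono-yes α (suc β)))
  ... | no ¬eq = trans (mono-no α β i j ¬eq)
                   (sym (mono-no α (suc β) i (suc j) (λ (e , f) → ¬eq (e , ℕ.suc-injective f))))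

  x^·-mono : ∀ m α β → (x^ m · mono α β) ≈ₚ mono (m ℕ.+ α) β
  x^·-mono zero α β = ≈ₚ-refl
  x^·-mono (suc m) α β = ≈ₚ-trans (x·-cong (x^·-mono m α β)) (x·-mono (m ℕ.+ α) β)

  y^·-mono : ∀ n α β → (y^ n · mono α β) ≈ₚ mono α (n ℕ.+ β)
  y^·-mono zero α β = ≈ₚ-refl
  y^·-mono (suc n) α β = ≈ₚ-trans (y·-cong (y^·-mono n α β)) (y·-mono α (n ℕ.+ β))

  x^·-binom : ∀ m α₁ α₂ β₁ β₂ → (x^ m · binom α₁ α₂ β₁ β₂) ≈ₚ binom (m ℕ.+ α₁) α₂ (m ℕ.+ β₁) β₂
  x^·-binom zero α₁ α₂ β₁ β₂ = ≈ₚ-refl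
  x^·-binom (suc m) α₁ α₂ β₁ β₂ i j = trans (x·-cong (x^·-binom m α₁ α₂ β₁ β₂) i j)
    (trans (x·-distrib-ₚ (mono (m ℕ.+ α₁) α₂) (mono (m ℕ.+ β₁) β₂) i j)
           (+-cong (x·-mono (m ℕ.+ α₁) α₂ i j) (-‿cong (x·-mono (m ℕ.+ β₁) β₂ i j))))

  y^·-binom : ∀ n α₁ α₂ β₁ β₂ → (y^ n · binom α₁ α₂ β₁ β₂) ≈ₚ binom α₁ (n ℕ.+ α₂) β₁ (n ℕ.+ β₂)
  y^·-binom zero α₁ α₂ β₁ β₂ = ≈ₚ-refl
  y^·-binom (suc n) α₁ α₂ β₁ β₂ i j = trans (y·-cong (y^·-binom n α₁ α₂ β₁ β₂) i j)
    (trans (y·-distrib-ₚ (mono α₁ (n ℕ.+ α₂)) (mono β₁ (n ℕ.+ β₂)) i j)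
           (+-cong (y·-mono α₁ (n ℕ.+ α₂) i j) (-‿cong (y·-mono β₁ (n ℕ.+ β₂) i j))))

  x^y^·-binom : ∀ m n α₁ α₂ β₁ β₂ → (x^ m · (y^ n · binom α₁ α₂ β₁ β₂)) ≈ₚ
    binom (m ℕ.+ α₁) (n ℕ.+ α₂) (m ℕ.+ β₁) (n ℕ.+ β₂)
  x^y^·-binom m n α₁ α₂ β₁ β₂ =
    ≈ₚ-trans (x^·-cong m (y^·-binom n α₁ α₂ β₁ β₂)) (x^·-binom m _ _ _ _)

  binom-≡ : ∀ {α₁ α₂ β₁ β₂ α₁′ α₂′ β₁′ β₂′} → α₁ ≡ α₁′ → α₂ ≡ α₂′ → β₁ ≡ β₁′ → β₂ ≡ β₂′ →
    binom α₁ α₂ β₁ β₂ ≡ binom α₁′ α₂′ β₁′ β₂′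
  binom-≡ ≡.refl ≡.refl ≡.refl ≡.refl = ≡.refl

  binom-self : ∀ α₁ α₂ → binom α₁ α₂ α₁ α₂ ≈ₚ 0ₚ
  binom-self α₁ α₂ i j = -‿inverseʳ _

  binom-swap : ∀ α₁ α₂ β₁ β₂ → binom β₁ β₂ α₁ α₂ ≈ₚ (-ₚ binom α₁ α₂ β₁ β₂)
  binom-swap α₁ α₂ β₁ β₂ i j = sym (⁻¹-anti-homo‿- _ _)

  -ₚ-telescope : ∀ p q r → (p -ₚ r) ≈ₚ ((p -ₚ q) +ₚ (q -ₚ r))
  -ₚ-telescope p q r i j = sym (begin
    (x + - y) + (y + - z)  ≈⟨ +-assoc x (- y) _ ⟩
    x + (- y + (y + - z))  ≈⟨ +-cong refl (+-assoc (- y) y _) ⟨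
    x + ((- y + y) + - z)  ≈⟨ +-cong refl (+-cong (-‿inverseˡ y) refl) ⟩
    x + (0# + - z)         ≈⟨ +-cong refl (+-identityˡ _) ⟩
    x + - z                ∎)
    where
    open SetoidReasoning setoid
    x = p i j
    y = q i j
    z = r i j

  finiteSupport-0 : FiniteSupport 0ₚ
  finiteSupport-0 = 0 , λ i j _ → refl

  finiteSupport-+ : ∀ {p q} → FiniteSupport p → FiniteSupport q → FiniteSupport (p +ₚ q)
  finiteSupport-+ (M , p≈0) (N , q≈0) = M ℕ.+ N , λ i j M+N≤i+j →
    trans (+-cong (p≈0 i j (ℕ.≤-trans (ℕ.m≤m+n M N) M+N≤i+j))
                  (q≈0 i j (ℕ.≤-trans (ℕ.m≤n+m N M) M+N≤i+j)))
          (+-identityˡ 0#)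

  finiteSupport-neg : ∀ {p} → FiniteSupport p → FiniteSupport (-ₚ p)
  finiteSupport-neg (N , p≈0) = N , λ i j N≤i+j → trans (-‿cong (p≈0 i j N≤i+j)) -0#≈0#

  finiteSupport-x· : ∀ {p} → FiniteSupport p → FiniteSupport (x· p)
  finiteSupport-x· {p} (N , p≈0) = suc N , x·p≈0
    where
    x·p≈0 : ∀ i j → suc N ℕ.≤ i ℕ.+ j → (x· p) i j ≈ 0#
    x·p≈0 zero j _ = refl
    x·p≈0 (suc i) j (s≤s N≤i+j) = p≈0 i j N≤i+j

  finiteSupport-y· : ∀ {p} → FiniteSupport p → FiniteSupport (y· p)
  finiteSupport-y· {p} (N , p≈0) = suc N , y·p≈0
    where
    y·p≈0 : ∀ i j → suc N ℕ.≤ i ℕ.+ j → (y· p) i j ≈ 0#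
    y·p≈0 i zero _ = refl
    y·p≈0 i (suc j) N<i+1+j = p≈0 i j (ℕ.≤-pred (≡.subst (suc N ℕ.≤_) (ℕ.+-suc i j) N<i+1+j))

  module _ (f : Pol) where

    InPrincipal-resp : ∀ {p p′} → p ≈ₚ p′ → InPrincipal f p′ → InPrincipal f p
    InPrincipal-resp p≈p′ (q , q-fin , p′≈qf) = q , q-fin , ≈ₚ-trans p≈p′ p′≈qf

    InPrincipal-0 : InPrincipal f 0ₚ
    InPrincipal-0 = 0ₚ , finiteSupport-0 , ≈ₚ-sym (*ₚ-zeroˡ f)

    InPrincipal-+ : ∀ {p p′} → InPrincipal f p → InPrincipal f p′ → InPrincipal f (p +ₚ p′)
    InPrincipal-+ (q , q-fin , p≈qf) (q′ , q′-fin , p′≈q′f) =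
      q +ₚ q′ , finiteSupport-+ q-fin q′-fin ,
      ≈ₚ-trans (λ i j → +-cong (p≈qf i j) (p′≈q′f i j)) (≈ₚ-sym (*ₚ-distribʳ q q′ f))

    -- Unlike membership in (f), this is closed under x· and y· without needing
    -- associativity of _*ₚ_.
    MultiplesIn : Pol → Set (c ⊔ ℓ)
    MultiplesIn g = ∀ q → FiniteSupport q → InPrincipal f (q *ₚ g)

    multiples-resp : ∀ {g h} → g ≈ₚ h → MultiplesIn g → MultiplesIn h
    multiples-resp g≈h g-mult q q-fin = InPrincipal-resp (*ₚ-congʳ q (≈ₚ-sym g≈h)) (g-mult q q-fin)

    multiples-self : MultiplesIn f
    multiples-self q q-fin = q , q-fin , ≈ₚ-refl

    multiples-0 : MultiplesIn 0ₚ
    multiples-0 q _ = InPrincipal-resp (*ₚ-zeroʳ q) InPrincipal-0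

    multiples-+ : ∀ {g h} → MultiplesIn g → MultiplesIn h → MultiplesIn (g +ₚ h)
    multiples-+ {g} {h} g-mult h-mult q q-fin =
      InPrincipal-resp (*ₚ-distribˡ q g h) (InPrincipal-+ (g-mult q q-fin) (h-mult q q-fin))

    multiples-neg : ∀ {g} → MultiplesIn g → MultiplesIn (-ₚ g)
    multiples-neg {g} g-mult q q-fin with g-mult q q-fin
    ... | r , r-fin , qg≈rf = -ₚ r , finiteSupport-neg r-fin ,
      ≈ₚ-trans (*ₚ-negʳ q g) (≈ₚ-trans (λ i j → -‿cong (qg≈rf i j)) (≈ₚ-sym (*ₚ-negˡ r f)))

    multiples-x· : ∀ {g} → MultiplesIn g → MultiplesIn (x· g)
    multiples-x· {g} g-mult q q-fin with g-mult q q-fin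
    ... | r , r-fin , qg≈rf = x· r , finiteSupport-x· r-fin ,
      ≈ₚ-trans (*ₚ-x·ʳ q g) (≈ₚ-trans (x·-cong qg≈rf) (≈ₚ-sym (*ₚ-x·ˡ r f)))

    multiples-y· : ∀ {g} → MultiplesIn g → MultiplesIn (y· g)
    multiples-y· {g} g-mult q q-fin with g-mult q q-fin
    ... | r , r-fin , qg≈rf = y· r , finiteSupport-y· r-fin ,
      ≈ₚ-trans (*ₚ-y·ʳ q g) (≈ₚ-trans (y·-cong qg≈rf) (≈ₚ-sym (*ₚ-y·ˡ r f)))

    multiples-x^· : ∀ m {g} → MultiplesIn g → MultiplesIn (x^ m · g)
    multiples-x^· zero g-mult = g-mult
    multiples-x^· (suc m) {g} g-mult = multiples-x· {x^ m · g} (multiples-x^· m g-mult)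

    multiples-y^· : ∀ n {g} → MultiplesIn g → MultiplesIn (y^ n · g)
    multiples-y^· zero g-mult = g-mult
    multiples-y^· (suc n) {g} g-mult = multiples-y· {y^ n · g} (multiples-y^· n g-mult)

    InIdeal⇒InPrincipal : ∀ {G : Set} {g : G → Pol} → (∀ t → MultiplesIn (g t)) →
      ∀ {p} → InIdeal g p → InPrincipal f p
    InIdeal⇒InPrincipal {g = g} g-mult (l , l-fin , p≈) = InPrincipal-resp p≈ (combination l l-fin)
      where
      combination : ∀ l → All (λ ct → FiniteSupport (proj₁ ct)) l → InPrincipal f (combine g l)
      combination [] [] = InPrincipal-0
      combination ((q , t) ∷ l) (q-fin ∷ l-fin) =
        InPrincipal-+ (g-mult t q q-fin) (combination l l-fin)

    InPrincipal⇒InIdeal : ∀ {G : Set} {g : G → Pol} t → g t ≈ₚ f →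
      ∀ {p} → InPrincipal f p → InIdeal g p
    InPrincipal⇒InIdeal t gt≈f (q , q-fin , p≈qf) =
      ((q , t) ∷ []) , (q-fin ∷ []) ,
      λ i j → trans (p≈qf i j) (trans (*ₚ-congʳ q (≈ₚ-sym gt≈f) i j) (sym (+-identityʳ _)))

module DefiningBinomial {c ℓ} (K : Field c ℓ) (a b : ℕ) where
  open Poly K
  open Polynomials K
  open SumsetsOfPairs
  open import Data.Nat using (NonZero; zero; suc; _+_; _*_; _∸_; _≤_)
  open import Data.Nat.Properties
    using (+-identityʳ; +-assoc; +-comm; m∸n+n≡m; ≤-trans; m≤m+n; ∸-monoˡ-≤; m≤n+m∸n)
  open import Data.Nat.Coprimality using (Coprime)
  open import Data.Nat.Tactic.RingSolver using (solve-∀)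
  open import Data.Product using (_,_; proj₁; proj₂)
  open import Data.Sum using (inj₁; inj₂)
  open import Relation.Binary.PropositionalEquality as ≡ using (_≡_; cong; cong₂)
  import Relation.Binary.Reasoning.Setoid as SetoidReasoning

  F : Pol
  F = mono (b ∸ 1) (a ∸ 1) *ₚ (mono b 0 -ₚ mono 0 a)

  F≈binom : F ≈ₚ binom (b ∸ 1 + b) (a ∸ 1) (b ∸ 1) (a ∸ 1 + a)
  F≈binom = begin
    mono B A *ₚ G                                  ≈⟨ *ₚ-congˡ G (≈ₚ-sym monoBA≈) ⟩
    (x^ B · (y^ A · mono 0 0)) *ₚ G                ≈⟨ *ₚ-x^·ˡ B _ G ⟩
    x^ B · ((y^ A · mono 0 0) *ₚ G)                ≈⟨ x^·-cong B (*ₚ-y^·ˡ A _ G) ⟩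
    x^ B · (y^ A · (mono 0 0 *ₚ G))                ≈⟨ x^·-cong B (y^·-cong A (*ₚ-identityˡ G)) ⟩
    x^ B · (y^ A · G)                              ≈⟨ x^y^·-binom B A b 0 0 a ⟩
    binom (B + b) (A + 0) (B + 0) (A + a)
      ≡⟨ binom-≡ ≡.refl (+-identityʳ A) (+-identityʳ B) ≡.refl ⟩
    binom (B + b) A B (A + a)                      ∎
    where
    open SetoidReasoning ≈ₚ-setoid
    B = b ∸ 1
    A = a ∸ 1
    G = mono b 0 -ₚ mono 0 a
    monoBA≈ : (x^ B · (y^ A · mono 0 0)) ≈ₚ mono B A
    monoBA≈ = ≈ₚ-trans (x^·-cong B (y^·-mono A 0 0)) (≈ₚ-trans (x^·-mono B 0 (A + 0))
      (≈ₚ-reflexive (cong₂ mono (+-identityʳ B) (+-identityʳ A))))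

  exchange-multiple : ∀ {P Q} → b ∸ 1 ≤ P → a ∸ 1 ≤ Q → MultiplesIn F (binom (P + b) Q P (Q + a))
  exchange-multiple {P} {Q} B≤P A≤Q = ≡.subst (MultiplesIn F) shifted≡
    (multiples-resp F (x^y^·-binom m n (B + b) A B (A + a))
      (multiples-x^· F m (multiples-y^· F n (multiples-resp F F≈binom (multiples-self F)))))
    where
    B = b ∸ 1
    A = a ∸ 1
    m = P ∸ B
    n = Q ∸ A
    shifted≡ : binom (m + (B + b)) (n + A) (m + B) (n + (A + a)) ≡ binom (P + b) Q P (Q + a)
    shifted≡ = binom-≡ (≡.trans (≡.sym (+-assoc m B b)) (cong (_+ b) (m∸n+n≡m B≤P)))
                       (m∸n+n≡m A≤Q)
                       (m∸n+n≡m B≤P)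
                       (≡.trans (≡.sym (+-assoc n A a)) (cong (_+ a) (m∸n+n≡m A≤Q)))

  -- x^(s b) - y^(s a) telescopes into the terms x^(t b) y^((s-1-t) a) (x^b - y^a), t < s.
  exchange-multiples : ∀ s {P Q} → b ∸ 1 ≤ P → a ∸ 1 ≤ Q →
    MultiplesIn F (binom (P + s * b) Q P (Q + s * a))
  exchange-multiples zero {P} {Q} _ _ = ≡.subst (MultiplesIn F)
    (binom-≡ (≡.sym (+-identityʳ P)) ≡.refl ≡.refl (≡.sym (+-identityʳ Q)))
    (multiples-resp F (≈ₚ-sym (binom-self P Q)) (multiples-0 F))
  exchange-multiples (suc s) {P} {Q} B≤P A≤Q = ≡.subst (MultiplesIn F) regrouped
    (multiples-resp F (≈ₚ-sym (-ₚ-telescope far middle near))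
      (multiples-+ F {far -ₚ middle} {middle -ₚ near}
        (exchange-multiples s (≤-trans B≤P (m≤m+n P b)) A≤Q)
        (exchange-multiple B≤P (≤-trans A≤Q (m≤m+n Q (s * a))))))
    where
    far = mono (P + b + s * b) Q
    middle = mono (P + b) (Q + s * a)
    near = mono P (Q + s * a + a)
    regroup : ∀ P b s → P + b + s * b ≡ P + suc s * b
    regroup = solve-∀
    regrouped : binom (P + b + s * b) Q P (Q + s * a + a) ≡
                binom (P + suc s * b) Q P (Q + suc s * a)
    regrouped = binom-≡ (regroup P b s) ≡.refl ≡.refl
      (≡.trans (+-assoc Q (s * a) a) (cong (Q +_) (+-comm (s * a) a)))

  exchange⇒multiple : ∀ {α₁ α₂ β₁ β₂} → Exchange a b α₁ α₂ β₁ β₂ →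
    MultiplesIn F (binom α₁ α₂ β₁ β₂)
  exchange⇒multiple ex =
    ≡.subst (MultiplesIn F) (binom-≡ (≡.sym α₁-eq) ≡.refl ≡.refl (≡.sym β₂-eq))
    (exchange-multiples steps (∸-monoˡ-≤ 1 b≤1+β₁) (∸-monoˡ-≤ 1 a≤1+α₂))
    where open Exchange ex

  sumsetGen-multiples : ∀ {k} → Coprime a b →
    .{{_ : NonZero a}} → .{{_ : NonZero b}} → .{{_ : NonZero k}} →
    ∀ r → MultiplesIn F (sumsetGen K (pair0 (k * a)) (pair0 (k * b)) r)
  sumsetGen-multiples cop record { α₁ = α₁ ; α₂ = α₂ ; β₁ = β₁ ; β₂ = β₂ ; rel = rel }
    with classify α₁ α₂ β₁ β₂ cop (span-unscale α₁ α₂ β₁ β₂ (λ {n} → proj₁ (rel n)))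
                                  (span-unscale β₁ β₂ α₁ α₂ (λ {n} → proj₂ (rel n)))
  ... | inj₁ (≡.refl , ≡.refl) = multiples-resp F (≈ₚ-sym (binom-self α₁ α₂)) (multiples-0 F)
  ... | inj₂ (inj₁ ex) = exchange⇒multiple ex
  ... | inj₂ (inj₂ ex) = multiples-resp F (≈ₚ-sym (binom-swap β₁ β₂ α₁ α₂))
                           (multiples-neg F {binom β₁ β₂ α₁ α₂} (exchange⇒multiple ex))

  definingRelation : ∀ k → SumsetRel (pair0 (k * a)) (pair0 (k * b))
  definingRelation k = record
    { α₁ = b ∸ 1 + b ; α₂ = a ∸ 1 ; β₁ = b ∸ 1 ; β₂ = a ∸ 1 + a
    ; rel = span-exchange (b ∸ 1) (a ∸ 1) (swap-factors k a b) (m≤n+m∸n b 1) (m≤n+m∸n a 1)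
    }
    where
    swap-factors : ∀ k a b → k * a * b ≡ k * b * a
    swap-factors = solve-∀

open import Level using (Level)
open import Data.Nat using (ℕ; _*_; _∸_; _≤_; _<_)
open import Data.Nat.GCD using (gcd)
open import Data.Product using (_×_; _,_)
open import Relation.Binary.PropositionalEquality using (_≡_)
open import Data.Nat using (>-nonZero)
open import Data.Nat.Properties using (≤-trans; <⇒≤)
open import Data.Nat.Coprimality using (gcd≡1⇒coprime)

theorem9 : ∀ {c ℓ : Level} (K : Field c ℓ) (a b k : ℕ) →
    1 ≤ a → a < b → gcd a b ≡ 1 → 1 ≤ k →
    let open Poly K in
    ∀ (p : Pol) → FiniteSupport p →
      (InSumsetIdeal K (pair0 (k * a)) (pair0 (k * b)) p →
        InPrincipal (mono (b ∸ 1) (a ∸ 1) *ₚ (mono b 0 -ₚ mono 0 a)) p)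
      × (InPrincipal (mono (b ∸ 1) (a ∸ 1) *ₚ (mono b 0 -ₚ mono 0 a)) p →
        InSumsetIdeal K (pair0 (k * a)) (pair0 (k * b)) p)
theorem9 K a b k 1≤a a<b gcd≡1 1≤k p _ =
  InIdeal⇒InPrincipal F (sumsetGen-multiples (gcd≡1⇒coprime gcd≡1)
    {{>-nonZero 1≤a}} {{>-nonZero (≤-trans 1≤a (<⇒≤ a<b))}} {{>-nonZero 1≤k}}) ,
  InPrincipal⇒InIdeal F (definingRelation k) (≈ₚ-sym F≈binom)
  where
  open Polynomials K
  open DefiningBinomial K a b
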